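{- Let $G$ be the simple graph with vertex set $\{v_1,\dots,v_{12}\}$ and the $20$ edges $v_2v_9, v_9v_{10}, v_{10}v_2, v_2v_1, v_1v_{10}, v_{10}v_3, v_3v_4, v_4v_{10}, v_{10}v_{11}, v_{11}v_4, v_6v_5, v_5v_{12}, v_{12}v_6, v_6v_9, v_9v_{12}, v_{12}v_{11}, v_{11}v_8, v_8v_{12}, v_{12}v_7, v_7v_8$. Then $G$ is connected, has an even number $m=20$ of edges, and the map $g$ given by $g(v_1)=v_1v_2v_{10}v_1$, $g(v_2)=v_2v_9v_{10}v_2$, $g(v_3)=v_3v_{10}v_4v_3$, $g(v_4)=v_4v_{10}v_{11}v_4$, $g(v_5)=v_5v_6v_{12}v_5$, $g(v_6)=v_6v_9v_{12}v_6$, $g(v_7)=v_7v_8v_{12}v_7$, $g(v_8)=v_8v_{11}v_{12}v_8$, $g(v_9)=v_9v_2v_1v_{10}v_9$, $g(v_{10})=v_{10}v_3v_4v_{11}v_{10}$, $g(v_{11})=v_{11}v_8v_7v_{12}v_{11}$, $g(v_{12})=v_{12}v_5v_6v_9v_{12}$ is a bijection from the vertex set onto a set $\mathcal{C}$ of closed trails such that each $v$ lies on $g(v)$, the total number of edges of the trails in $\mathcal{C}$ is $2m$, and each edge of $G$ lies on exactly two trails of $\mathcal{C}$; nevertheless $G$ has no identity permutation ordering.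
   Context: For an edge $e$ with endvertices $u,v$ let $\tau_e=(u\ v)$, a transposition of the vertex set. For an edge ordering (linear order of the edge set) $\omega=(e_1,\dots,e_m)$ put $\pi_\omega=\tau_{e_m}\cdots\tau_{e_1}$. An edge ordering $\omega$ is an identity permutation ordering if $\pi_\omega$ is the identity permutation. -}

module Defs where

open import Data.Nat using (ℕ; zero; suc; _+_)
import Data.Nat
open import Data.Fin using (Fin; #_)
open import Data.Fin.Properties using (_≟_)
open import Data.Product using (_×_; _,_; Σ; ∃; ∃-syntax)
open import Data.Sum using (_⊎_)
open import Data.List using (List; []; _∷_; length; foldl; sum; map; last)
open import Data.Maybe using (just)
open import Data.List.Membership.Propositional using (_∈_)
open import Data.List.Relation.Unary.All using (All)
open import Data.List.Relation.Unary.Any using (Any)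
open import Data.List.Relation.Unary.AllPairs using (AllPairs)
open import Data.List.Relation.Binary.Permutation.Propositional using (_↭_)
open import Relation.Nullary using (¬_; yes; no)
open import Relation.Binary.PropositionalEquality using (_≡_)
open import Function using (Injective)

Edge : ℕ → Set
Edge n = Fin n × Fin n

SameEdge : ∀ {n} → Edge n → Edge n → Set
SameEdge (a , b) (c , d) = (a ≡ c × b ≡ d) ⊎ (a ≡ d × b ≡ c)

Adjacent : ∀ {n} → List (Edge n) → Fin n → Fin n → Set
Adjacent E u v = Any (SameEdge (u , v)) E

data Walk {n} (E : List (Edge n)) : Fin n → Fin n → Set where
  stay : ∀ {u} → Walk E u u
  step : ∀ {u v w} → Adjacent E u v → Walk E v w → Walk E u w

Connected : ∀ {n} → List (Edge n) → Set
Connected {n} E = (u v : Fin n) → Walk E u v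

-- A trail is represented by its vertex sequence x₀ x₁ … x_k;
-- its edges are the consecutive pairs (x_{i}, x_{i+1}).
steps : ∀ {n} → List (Fin n) → List (Edge n)
steps []            = []
steps (x ∷ [])      = []
steps (x ∷ y ∷ xs)  = (x , y) ∷ steps (y ∷ xs)

IsClosedTrail : ∀ {n} → List (Edge n) → List (Fin n) → Set
IsClosedTrail E []       = Data.Empty.⊥
  where import Data.Empty
IsClosedTrail E (x ∷ xs) =
  1 Data.Nat.≤ length (steps (x ∷ xs)) ×
  last (x ∷ xs) ≡ just x ×
  All (λ p → Adjacent E (Data.Product.proj₁ p) (Data.Product.proj₂ p)) (steps (x ∷ xs)) ×
  AllPairs (λ p q → ¬ SameEdge p q) (steps (x ∷ xs))

trailLength : ∀ {n} → List (Fin n) → ℕ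
trailLength t = length (steps t)

EdgeOn : ∀ {n} → Edge n → List (Fin n) → Set
EdgeOn e t = Any (SameEdge e) (steps t)

transp : ∀ {n} → Edge n → Fin n → Fin n
transp (u , v) x with x ≟ u
... | yes _ = v
... | no _ with x ≟ v
...   | yes _ = u
...   | no _  = x

-- π_ω = τ_{e_m} ⋯ τ_{e_1}  (τ_{e_1} is applied first)
permOf : ∀ {n} → List (Edge n) → Fin n → Fin n
permOf ω x = foldl (λ y e → transp e y) x ω

-- ω is an edge ordering: a linear order of the edge set, i.e. a list
-- containing each edge exactly once (a permutation of E)
IsEdgeOrdering : ∀ {n} → List (Edge n) → List (Edge n) → Set
IsEdgeOrdering E ω = ω ↭ E

IsIdentityPermutationOrdering : ∀ {n} → List (Edge n) → List (Edge n) → Set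
IsIdentityPermutationOrdering {n} E ω =
  IsEdgeOrdering E ω × ((x : Fin n) → permOf ω x ≡ x)

HasIdentityPermutationOrdering : ∀ {n} → List (Edge n) → Set
HasIdentityPermutationOrdering E = ∃[ ω ] IsIdentityPermutationOrdering E ω

V : Set
V = Fin 12

v₁ v₂ v₃ v₄ v₅ v₆ v₇ v₈ v₉ v₁₀ v₁₁ v₁₂ : V
v₁ = # 0
v₂ = # 1
v₃ = # 2
v₄ = # 3
v₅ = # 4
v₆ = # 5
v₇ = # 6
v₈ = # 7
v₉ = # 8
v₁₀ = # 9
v₁₁ = # 10
v₁₂ = # 11

edgesG : List (Edge 12)
edgesG =
  (v₂ , v₉) ∷ (v₉ , v₁₀) ∷ (v₁₀ , v₂) ∷ (v₂ , v₁) ∷ (v₁ , v₁₀) ∷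
  (v₁₀ , v₃) ∷ (v₃ , v₄) ∷ (v₄ , v₁₀) ∷ (v₁₀ , v₁₁) ∷ (v₁₁ , v₄) ∷
  (v₆ , v₅) ∷ (v₅ , v₁₂) ∷ (v₁₂ , v₆) ∷ (v₆ , v₉) ∷ (v₉ , v₁₂) ∷
  (v₁₂ , v₁₁) ∷ (v₁₁ , v₈) ∷ (v₈ , v₁₂) ∷ (v₁₂ , v₇) ∷ (v₇ , v₈) ∷ []

g : V → List V
g x with Data.Fin.toℕ x
  where import Data.Fin
... | 0  = v₁ ∷ v₂ ∷ v₁₀ ∷ v₁ ∷ []
... | 1  = v₂ ∷ v₉ ∷ v₁₀ ∷ v₂ ∷ []
... | 2  = v₃ ∷ v₁₀ ∷ v₄ ∷ v₃ ∷ []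
... | 3  = v₄ ∷ v₁₀ ∷ v₁₁ ∷ v₄ ∷ []
... | 4  = v₅ ∷ v₆ ∷ v₁₂ ∷ v₅ ∷ []
... | 5  = v₆ ∷ v₉ ∷ v₁₂ ∷ v₆ ∷ []
... | 6  = v₇ ∷ v₈ ∷ v₁₂ ∷ v₇ ∷ []
... | 7  = v₈ ∷ v₁₁ ∷ v₁₂ ∷ v₈ ∷ []
... | 8  = v₉ ∷ v₂ ∷ v₁ ∷ v₁₀ ∷ v₉ ∷ []
... | 9  = v₁₀ ∷ v₃ ∷ v₄ ∷ v₁₁ ∷ v₁₀ ∷ []
... | 10 = v₁₁ ∷ v₈ ∷ v₇ ∷ v₁₂ ∷ v₁₁ ∷ []
... | _  = v₁₂ ∷ v₅ ∷ v₆ ∷ v₉ ∷ v₁₂ ∷ []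

allV : List V
allV = v₁ ∷ v₂ ∷ v₃ ∷ v₄ ∷ v₅ ∷ v₆ ∷ v₇ ∷ v₈ ∷ v₉ ∷ v₁₀ ∷ v₁₁ ∷ v₁₂ ∷ []

-- Let x be a vertex with exactly two incident edges c = xu and d = xw, neither a loop.
-- An identity permutation ordering has the shape ω = B, c, S, d, A with x on
-- no edge of B, S, A.  Following x through π_ω: c sends it to u, and since
-- A cannot bring anything back to x, d must, so S carries u to w.  Hence
-- τ_d ∘ π_S ∘ τ_c agrees with π_S away from x, and deleting c and d leaves an
-- identity permutation ordering of G − x.  In G the vertices v₁, …, v₉ can be
-- deleted in turn this way, after which v₁₀ has degree one; but a vertex of
-- degree one is moved by its unique transposition and never moved back.
module Submission where

open import Defs
open import Data.Nat using (ℕ; _*_; _≤?_)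
open import Data.Fin as Fin using (Fin)
open import Data.Fin.Patterns using (0F; 1F; 2F; 3F; 4F; 5F; 6F; 7F; 8F; 9F)
open import Data.Fin.Properties using (_≟_; all?; any?)
open import Data.Product using (_×_; _,_; ∃-syntax; ∃₂)
open import Data.Sum using (_⊎_; inj₁; inj₂)
open import Data.Empty using (⊥-elim)
open import Data.List using (List; []; _∷_; _++_; length; map; head; last; filter)
open import Data.List.Properties using (foldl-++; ∷-injective; filter-++; filter-all; filter-accept; filter-reject)
open import Data.Nat.ListAction using (sum)
open import Data.Maybe using (just)
import Data.Maybe.Properties as Maybe
open import Data.List.Membership.Propositional using (_∈_)
open import Data.List.Membership.Propositional.Properties using (∈-filter⁺)
open import Data.List.Membership.DecPropositional (_≟_ {12}) using (_∈?_)
open import Data.List.Relation.Unary.All as All using (All; []; _∷_)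
open import Data.List.Relation.Unary.All.Properties using (++⁺)
open import Data.List.Relation.Unary.Any.Properties using (¬Any[])
open import Data.List.Relation.Unary.Any as Any using (here; there)
open import Data.List.Relation.Unary.AllPairs using (allPairs?)
open import Data.List.Relation.Binary.Permutation.Propositional using (_↭_; ↭-refl; ↭-trans; ↭-swap)
open import Data.List.Relation.Binary.Permutation.Propositional.Properties
  using (↭-length; ∈-resp-↭; ↭-singleton-inv; drop-∷; filter-↭)
open import Relation.Nullary using (¬_; Dec; yes; no; ¬?)
open import Relation.Nullary.Decidable using (True; toWitness; _×-dec_; _⊎-dec_; _→-dec_)
open import Relation.Unary using (∁)
open import Relation.Unary.Properties using (∁?)
open import Relation.Binary.PropositionalEquality
  using (_≡_; _≢_; refl; sym; trans; cong; subst; module ≡-Reasoning)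
open import Function using (Injective; _∘_)

private
  variable
    n : ℕ
    a b u w x y : Fin n
    c d : Edge n
    E : List (Edge n)

transp-left : (a b : Fin n) → transp (a , b) a ≡ b
transp-left a b with a ≟ a
... | yes _  = refl
... | no a≢a = ⊥-elim (a≢a refl)

transp-right : (a b : Fin n) → transp (a , b) b ≡ a
transp-right a b with b ≟ a
... | yes b≡a = b≡a
... | no _ with b ≟ b
...   | yes _  = refl
...   | no b≢b = ⊥-elim (b≢b refl)

transp-other : y ≢ a → y ≢ b → transp (a , b) y ≡ y
transp-other {y = y} {a} {b} y≢a y≢b with y ≟ a
... | yes y≡a = ⊥-elim (y≢a y≡a)
... | no _ with y ≟ b
...   | yes y≡b = ⊥-elim (y≢b y≡b)
...   | no _    = refl

transp-involutive : (e : Edge n) (y : Fin n) → transp e (transp e y) ≡ y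
transp-involutive (a , b) y with y ≟ a
... | yes refl = transp-right a b
... | no y≢a with y ≟ b
...   | yes refl = transp-left a b
...   | no y≢b   = transp-other y≢a y≢b

transp-injective : (e : Edge n) → Injective _≡_ _≡_ (transp e)
transp-injective e {y} {z} eq = begin
  y                         ≡⟨ sym (transp-involutive e y) ⟩
  transp e (transp e y)     ≡⟨ cong (transp e) eq ⟩
  transp e (transp e z)     ≡⟨ transp-involutive e z ⟩
  z                         ∎
  where open ≡-Reasoning

Joins : Edge n → Fin n → Fin n → Set
Joins c x u = c ≡ (x , u) ⊎ c ≡ (u , x)

joins-transp-from : Joins c x u → transp c x ≡ u
joins-transp-from {x = x} {u} (inj₁ refl) = transp-left x u
joins-transp-from {x = x} {u} (inj₂ refl) = transp-right u x

joins-transp-to : Joins c x u → transp c u ≡ x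
joins-transp-to {x = x} {u} (inj₁ refl) = transp-right x u
joins-transp-to {x = x} {u} (inj₂ refl) = transp-left u x

joins-transp-other : Joins c x u → y ≢ x → y ≢ u → transp c y ≡ y
joins-transp-other (inj₁ refl) y≢x y≢u = transp-other y≢x y≢u
joins-transp-other (inj₂ refl) y≢x y≢u = transp-other y≢u y≢x

joins-preimage : Joins d x w → w ≢ x → transp d y ≡ x → y ≡ w
joins-preimage {x = x} {w} {y} d-xw w≢x dy≡x with y ≟ x
... | yes refl = ⊥-elim (w≢x (trans (sym (joins-transp-from d-xw)) dy≡x))
... | no y≢x with y ≟ w
...   | yes y≡w = y≡w
...   | no y≢w  = ⊥-elim (y≢x (trans (sym (joins-transp-other d-xw y≢x y≢w)) dy≡x))

Touches : Fin n → Edge n → Set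
Touches x (a , b) = x ≡ a ⊎ x ≡ b

touches? : (x : Fin n) (e : Edge n) → Dec (Touches x e)
touches? x (a , b) = (x ≟ a) ⊎-dec (x ≟ b)

joins⇒touches : Joins c x u → Touches x c
joins⇒touches (inj₁ refl) = inj₁ refl
joins⇒touches (inj₂ refl) = inj₂ refl

Avoids : Fin n → List (Edge n) → Set
Avoids x = All (∁ (Touches x))

incident : Fin n → List (Edge n) → List (Edge n)
incident x = filter (touches? x)

-- the edge list of G − x; the vertex x itself stays, isolated
avoiding : Fin n → List (Edge n) → List (Edge n)
avoiding x = filter (∁? (touches? x))

transp-fixes-untouched : ¬ Touches x (a , b) → transp (a , b) x ≡ x
transp-fixes-untouched ¬t = transp-other (¬t ∘ inj₁) (¬t ∘ inj₂)

IsIdentity : (Fin n → Fin n) → Set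
IsIdentity {n} σ = (y : Fin n) → σ y ≡ y

permOf-++ : (xs ys : List (Edge n)) (y : Fin n) → permOf (xs ++ ys) y ≡ permOf ys (permOf xs y)
permOf-++ xs ys y = foldl-++ (λ z e → transp e z) y xs ys

permOf-injective : (ω : List (Edge n)) → Injective _≡_ _≡_ (permOf ω)
permOf-injective []      eq = eq
permOf-injective (e ∷ ω) eq = transp-injective e (permOf-injective ω eq)

avoids⇒permOf-fixes : (ω : List (Edge n)) → Avoids x ω → permOf ω x ≡ x
avoids⇒permOf-fixes []            []         = refl
avoids⇒permOf-fixes ((a , b) ∷ ω) (¬t ∷ ¬ts) =
  trans (cong (permOf ω) (transp-fixes-untouched ¬t)) (avoids⇒permOf-fixes ω ¬ts)

avoids⇒permOf-reflects : (ω : List (Edge n)) → Avoids x ω → permOf ω y ≡ x → y ≡ x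
avoids⇒permOf-reflects ω avoids eq =
  permOf-injective ω (trans eq (sym (avoids⇒permOf-fixes ω avoids)))

incident≡[]⇒avoids : (ω : List (Edge n)) → incident x ω ≡ [] → Avoids x ω
incident≡[]⇒avoids {x = x} ω eq = All.tabulate λ e∈ω t →
  ¬Any[] (subst (_ ∈_) eq (∈-filter⁺ (touches? x) e∈ω t))

incident-split : (ω : List (Edge n)) {rest : List (Edge n)} → incident x ω ≡ c ∷ rest →
  ∃₂ λ B A → ω ≡ B ++ c ∷ A × Avoids x B × incident x A ≡ rest
incident-split {x = x} (e ∷ ω) eq with touches? x e
... | yes t with ∷-injective (trans (sym (filter-accept (touches? x) t)) eq)
...   | refl , eq′ = [] , ω , refl , [] , eq′
incident-split {x = x} (e ∷ ω) eq | no ¬t with incident-split ω (trans (sym (filter-reject (touches? x) ¬t)) eq)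
... | B , A , refl , avB , eq′ = e ∷ B , A , refl , ¬t ∷ avB , eq′

avoiding-around-two : (B S A : List (Edge n)) → Avoids x B → Avoids x S → Avoids x A →
  Touches x c → Touches x d → avoiding x (B ++ c ∷ S ++ d ∷ A) ≡ B ++ S ++ A
avoiding-around-two {x = x} {c = c} {d = d} B S A avB avS avA tc td = begin
  avoiding x (B ++ c ∷ S ++ d ∷ A)                   ≡⟨ filter-++ P? B (c ∷ S ++ d ∷ A) ⟩
  avoiding x B ++ avoiding x (c ∷ S ++ d ∷ A)        ≡⟨ cong (avoiding x B ++_) (filter-reject P? (λ ¬t → ¬t tc)) ⟩
  avoiding x B ++ avoiding x (S ++ d ∷ A)            ≡⟨ cong (avoiding x B ++_) (filter-++ P? S (d ∷ A)) ⟩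
  avoiding x B ++ avoiding x S ++ avoiding x (d ∷ A) ≡⟨ cong (λ L → avoiding x B ++ avoiding x S ++ L) (filter-reject P? (λ ¬t → ¬t td)) ⟩
  avoiding x B ++ avoiding x S ++ avoiding x A       ≡⟨ cong (λ L → L ++ avoiding x S ++ avoiding x A) (filter-all P? avB) ⟩
  B ++ avoiding x S ++ avoiding x A                  ≡⟨ cong (λ L → B ++ L ++ avoiding x A) (filter-all P? avS) ⟩
  B ++ S ++ avoiding x A                             ≡⟨ cong (λ L → B ++ S ++ L) (filter-all P? avA) ⟩
  B ++ S ++ A                                        ∎
  where
  open ≡-Reasoning
  P? = ∁? (touches? x)

↭-pair-inv : {xs : List (Edge n)} → xs ↭ c ∷ d ∷ [] → xs ≡ c ∷ d ∷ [] ⊎ xs ≡ d ∷ c ∷ []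
↭-pair-inv {xs = []}            r with ↭-length r
... | ()
↭-pair-inv {xs = _ ∷ []}        r with ↭-length r
... | ()
↭-pair-inv {xs = _ ∷ _ ∷ _ ∷ _} r with ↭-length r
... | ()
↭-pair-inv {c = c} {d} {xs = _ ∷ _ ∷ []} r with ∈-resp-↭ r (here refl)
... | here refl         = inj₁ (cong (c ∷_) (↭-singleton-inv (drop-∷ r)))
... | there (here refl) = inj₂ (cong (d ∷_) (↭-singleton-inv (drop-∷ (↭-trans r (↭-swap c d ↭-refl)))))
... | there (there ())

module DegreeTwo
  (w≢x : w ≢ x)
  (c-xu : Joins c x u) (d-xw : Joins d x w)
  (B S A : List (Edge n)) (avB : Avoids x B) (avS : Avoids x S) (avA : Avoids x A)
  (id : IsIdentity (permOf (B ++ c ∷ S ++ d ∷ A)))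
  where
  open ≡-Reasoning

  permOf-around-two : (y : Fin n) →
    permOf (B ++ c ∷ S ++ d ∷ A) y ≡ permOf A (transp d (permOf S (transp c (permOf B y))))
  permOf-around-two y = trans (permOf-++ B (c ∷ S ++ d ∷ A) y) (permOf-++ S (d ∷ A) _)

  middle-carries-u-to-w : permOf S u ≡ w
  middle-carries-u-to-w = joins-preimage d-xw w≢x (avoids⇒permOf-reflects A avA (begin
    permOf A (transp d (permOf S u))                            ≡⟨ cong (λ z → permOf A (transp d (permOf S z))) (sym (joins-transp-from c-xu)) ⟩
    permOf A (transp d (permOf S (transp c x)))                 ≡⟨ cong (λ z → permOf A (transp d (permOf S (transp c z)))) (sym (avoids⇒permOf-fixes B avB)) ⟩
    permOf A (transp d (permOf S (transp c (permOf B x))))      ≡⟨ sym (permOf-around-two x) ⟩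
    permOf (B ++ c ∷ S ++ d ∷ A) x                              ≡⟨ id x ⟩
    x                                                           ∎))

  cancel-around-middle : (z : Fin n) → z ≢ x → transp d (permOf S (transp c z)) ≡ permOf S z
  cancel-around-middle z z≢x with z ≟ u
  ... | yes refl = begin
    transp d (permOf S (transp c u))   ≡⟨ cong (transp d ∘ permOf S) (joins-transp-to c-xu) ⟩
    transp d (permOf S x)              ≡⟨ cong (transp d) (avoids⇒permOf-fixes S avS) ⟩
    transp d x                         ≡⟨ joins-transp-from d-xw ⟩
    w                                  ≡⟨ sym middle-carries-u-to-w ⟩
    permOf S u                         ∎
  ... | no z≢u = begin
    transp d (permOf S (transp c z))   ≡⟨ cong (transp d ∘ permOf S) (joins-transp-other c-xu z≢x z≢u) ⟩
    transp d (permOf S z)              ≡⟨ joins-transp-other d-xw (z≢x ∘ avoids⇒permOf-reflects S avS)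
                                            (z≢u ∘ permOf-injective S ∘ λ eq → trans eq (sym middle-carries-u-to-w)) ⟩
    permOf S z                         ∎

  identity-without : IsIdentity (permOf (B ++ S ++ A))
  identity-without y with y ≟ x
  ... | yes refl = avoids⇒permOf-fixes (B ++ S ++ A) (++⁺ avB (++⁺ avS avA))
  ... | no y≢x = begin
    permOf (B ++ S ++ A) y                                   ≡⟨ permOf-++ B (S ++ A) y ⟩
    permOf (S ++ A) (permOf B y)                             ≡⟨ permOf-++ S A _ ⟩
    permOf A (permOf S (permOf B y))                         ≡⟨ cong (permOf A) (sym (cancel-around-middle (permOf B y) (y≢x ∘ avoids⇒permOf-reflects B avB))) ⟩
    permOf A (transp d (permOf S (transp c (permOf B y))))   ≡⟨ sym (permOf-around-two y) ⟩
    permOf (B ++ c ∷ S ++ d ∷ A) y                           ≡⟨ id y ⟩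
    y                                                        ∎

identity-avoiding-degreeTwo : (ω : List (Edge n)) → incident x ω ≡ c ∷ d ∷ [] →
  Joins c x u → Joins d x w → w ≢ x →
  IsIdentity (permOf ω) → IsIdentity (permOf (avoiding x ω))
identity-avoiding-degreeTwo ω eq c-xu d-xw w≢x id
  with incident-split ω eq
... | B , R , refl , avB , eq′ with incident-split R eq′
... | S , A , refl , avS , eq″ =
  subst (IsIdentity ∘ permOf) (sym (avoiding-around-two B S A avB avS avA (joins⇒touches c-xu) (joins⇒touches d-xw)))
    (DegreeTwo.identity-without w≢x c-xu d-xw B S A avB avS avA id)
  where
  avA : Avoids _ A
  avA = incident≡[]⇒avoids A eq″

hasIPO-avoiding-degreeTwo : (x : Fin n) → incident x E ≡ c ∷ d ∷ [] →
  Joins c x u → Joins d x w → u ≢ x → w ≢ x →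
  HasIdentityPermutationOrdering E → HasIdentityPermutationOrdering (avoiding x E)
hasIPO-avoiding-degreeTwo x eq c-xu d-xw u≢x w≢x (ω , ω↭E , id) =
  avoiding x ω , filter-↭ _ ω↭E , identity
  where
  identity : IsIdentity (permOf (avoiding x ω))
  identity with ↭-pair-inv (subst (incident x ω ↭_) eq (filter-↭ (touches? x) ω↭E))
  ... | inj₁ eq′ = identity-avoiding-degreeTwo ω eq′ c-xu d-xw w≢x id
  ... | inj₂ eq′ = identity-avoiding-degreeTwo ω eq′ d-xw c-xu u≢x id

¬hasIPO-degreeOne : (x : Fin n) → incident x E ≡ c ∷ [] → Joins c x u → u ≢ x →
  ¬ HasIdentityPermutationOrdering E
¬hasIPO-degreeOne {c = c} {u = u} x eq c-xu u≢x (ω , ω↭E , id)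
  with incident-split ω (↭-singleton-inv (subst (incident x ω ↭_) eq (filter-↭ (touches? x) ω↭E)))
... | B , A , refl , avB , eq′ = u≢x (avoids⇒permOf-reflects A (incident≡[]⇒avoids A eq′) (begin
  permOf A u                          ≡⟨ cong (permOf A) (sym (joins-transp-from c-xu)) ⟩
  permOf A (transp c x)               ≡⟨ cong (permOf A ∘ transp c) (sym (avoids⇒permOf-fixes B avB)) ⟩
  permOf A (transp c (permOf B x))    ≡⟨ sym (permOf-++ B (c ∷ A) x) ⟩
  permOf (B ++ c ∷ A) x               ≡⟨ id x ⟩
  x                                   ∎))
  where open ≡-Reasoning

_++ʷ_ : Walk E u w → Walk E w y → Walk E u y
stay       ++ʷ q = q
step a↔b p ++ʷ q = step a↔b (p ++ʷ q)

adjacent-sym : Adjacent E u w → Adjacent E w u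
adjacent-sym = Any.map λ where
  (inj₁ (p , q)) → inj₂ (q , p)
  (inj₂ (p , q)) → inj₁ (q , p)

reverseʷ : Walk E u w → Walk E w u
reverseʷ stay         = stay
reverseʷ (step a↔b p) = reverseʷ p ++ʷ step (adjacent-sym a↔b) stay

connected-viaHub : (h : Fin n) → ((u : Fin n) → Walk E u h) → Connected E
connected-viaHub h toHub u w = toHub u ++ʷ reverseʷ (toHub w)

sameEdge? : (e f : Edge n) → Dec (SameEdge e f)
sameEdge? (a , b) (c , d) = ((a ≟ c) ×-dec (b ≟ d)) ⊎-dec ((a ≟ d) ×-dec (b ≟ c))

adjacent? : (E : List (Edge n)) (u w : Fin n) → Dec (Adjacent E u w)
adjacent? E u w = Any.any? (sameEdge? (u , w)) E

isClosedTrail? : (E : List (Edge n)) (t : List (Fin n)) → Dec (IsClosedTrail E t)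
isClosedTrail? E []       = no λ ()
isClosedTrail? E (x ∷ xs) =
  (1 ≤? length (steps (x ∷ xs)))
  ×-dec Maybe.≡-dec _≟_ (last (x ∷ xs)) (just x)
  ×-dec All.all? (λ (a , b) → adjacent? E a b) (steps (x ∷ xs))
  ×-dec allPairs? (λ e f → ¬? (sameEdge? e f)) (steps (x ∷ xs))

edgeOn? : (e : Edge n) (t : List (Fin n)) → Dec (EdgeOn e t)
edgeOn? e t = Any.any? (sameEdge? e) (steps t)

OnExactlyTwo : (Fin n → List (Fin n)) → Edge n → Set
OnExactlyTwo {n} trail e = ∃[ u ] ∃[ w ] (u ≢ w × EdgeOn e (trail u) × EdgeOn e (trail w)
  × ((x : Fin n) → EdgeOn e (trail x) → (x ≡ u ⊎ x ≡ w)))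

onExactlyTwo? : (trail : Fin n → List (Fin n)) (e : Edge n) → Dec (OnExactlyTwo trail e)
onExactlyTwo? trail e = any? λ u → any? λ w →
  ¬? (u ≟ w) ×-dec edgeOn? e (trail u) ×-dec edgeOn? e (trail w)
  ×-dec all? (λ x → edgeOn? e (trail x) →-dec ((x ≟ u) ⊎-dec (x ≟ w)))

hop : (u w : V) {adj : True (adjacent? edgesG u w)} → Walk edgesG w y → Walk edgesG u y
hop u w {adj} = step (toWitness adj)

toHub : (u : V) → Walk edgesG u v₁₀
toHub 0F                        = hop v₁ v₁₀ stay
toHub 1F                        = hop v₂ v₁₀ stay
toHub 2F                        = hop v₃ v₁₀ stay
toHub 3F                        = hop v₄ v₁₀ stay
toHub 4F                        = hop v₅ v₁₂ (hop v₁₂ v₁₁ (hop v₁₁ v₁₀ stay))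
toHub 5F                        = hop v₆ v₉ (hop v₉ v₁₀ stay)
toHub 6F                        = hop v₇ v₁₂ (hop v₁₂ v₁₁ (hop v₁₁ v₁₀ stay))
toHub 7F                        = hop v₈ v₁₁ (hop v₁₁ v₁₀ stay)
toHub 8F                        = hop v₉ v₁₀ stay
toHub 9F                        = stay
toHub (Fin.suc 9F)              = hop v₁₁ v₁₀ stay
toHub (Fin.suc (Fin.suc 9F))    = hop v₁₂ v₁₁ (hop v₁₁ v₁₀ stay)

g-injective : Injective _≡_ _≡_ g
g-injective {x} {y} gx≡gy =
  Maybe.just-injective (trans (sym (head-g x)) (trans (cong head gx≡gy) (head-g y)))
  where
  head-g : (x : V) → head (g x) ≡ just x
  head-g = toWitness {a? = all? λ x → Maybe.≡-dec _≟_ (head (g x)) (just x)} _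

noIdentityPermutationOrdering : ¬ HasIdentityPermutationOrdering edgesG
noIdentityPermutationOrdering =
    ¬hasIPO-degreeOne v₁₀ refl (inj₁ refl) (λ ())
  ∘ hasIPO-avoiding-degreeTwo v₉ refl (inj₁ refl) (inj₁ refl) (λ ()) (λ ())
  ∘ hasIPO-avoiding-degreeTwo v₈ refl (inj₂ refl) (inj₁ refl) (λ ()) (λ ())
  ∘ hasIPO-avoiding-degreeTwo v₇ refl (inj₂ refl) (inj₁ refl) (λ ()) (λ ())
  ∘ hasIPO-avoiding-degreeTwo v₆ refl (inj₂ refl) (inj₁ refl) (λ ()) (λ ())
  ∘ hasIPO-avoiding-degreeTwo v₅ refl (inj₂ refl) (inj₁ refl) (λ ()) (λ ())
  ∘ hasIPO-avoiding-degreeTwo v₄ refl (inj₁ refl) (inj₂ refl) (λ ()) (λ ())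
  ∘ hasIPO-avoiding-degreeTwo v₃ refl (inj₂ refl) (inj₁ refl) (λ ()) (λ ())
  ∘ hasIPO-avoiding-degreeTwo v₂ refl (inj₁ refl) (inj₂ refl) (λ ()) (λ ())
  ∘ hasIPO-avoiding-degreeTwo v₁ refl (inj₂ refl) (inj₁ refl) (λ ()) (λ ())

mainTheorem8 :
    Connected edgesG
    × length edgesG ≡ 20
    × Injective _≡_ _≡_ g
    × ((x : V) → IsClosedTrail edgesG (g x))
    × ((x : V) → x ∈ g x)
    × sum (map (λ x → trailLength (g x)) allV) ≡ 2 * length edgesG
    × ((e : Edge 12) → e ∈ edgesG →
         ∃[ u ] ∃[ w ] (u ≢ w × EdgeOn e (g u) × EdgeOn e (g w)
           × ((x : V) → EdgeOn e (g x) → (x ≡ u ⊎ x ≡ w))))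
    × ¬ HasIdentityPermutationOrdering edgesG
mainTheorem8 =
    connected-viaHub v₁₀ toHub
  , refl
  , g-injective
  , toWitness {a? = all? λ x → isClosedTrail? edgesG (g x)} _
  , toWitness {a? = all? λ x → x ∈? g x} _
  , refl
  , (λ e → All.lookup (toWitness {a? = All.all? (onExactlyTwo? g) edgesG} _))
  , noIdentityPermutationOrdering
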